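{- Work in the first-order language of lattices $\{\vee,\wedge\}$, writing $a+b$ for $a\vee b$, $ab$ for $a\wedge b$, and $a\le b$ as an abbreviation of the equation $a\vee b=b$. Define the following positive formulas: \begin{itemize} \item $\operatorname{NI}(x_1,x_2,x_3,x_4)$: $\big(\bigvee_{1\le i\le 4}\ x_i\le \sum_{j\ne i}x_j\big)$ OR $\big(\bigvee_{1\le i\le 4}\ x_i\ge \prod_{j\ne i}x_j\big)$ (here $\bigvee$ denotes logical disjunction); \item $t(u)$: $\forall w\ (w\le u)$; \quad $b(u)$: $\forall w\ (w\ge u)$; \item for a finite set of variables $X$ and intervals $I_1,\dots,I_m$ with explicitly given bounds, $\operatorname{CI}(X,I_1,\dots,I_m)$ is the formula $\&_{x\in X}\bigvee_{1\le j\le m}(x\in I_j)$, where $x\in[c,d]$ stands for $c\le x\ \&\ x\le d$. \end{itemize} Given variables $z_1,z_2,z_3$, for $i\in\{1,2,3\}$ with $\{j,k\}=\{1,2,3\}\setminus\{i\}$ define the intervals \[ I^{z_i}=[\,z_i+z_jz_k,\ z_i+(z_1+z_2)(z_1+z_3)(z_2+z_3)\,],\qquad J_{z_i}=[\,z_i(z_1z_2+z_1z_3+z_2z_3),\ z_i(z_j+z_k)\,],\] \[ K=[\,z_1z_2+z_1z_3+z_2z_3,\ (z_1+z_2)(z_1+z_3)(z_2+z_3)\,].\] Let $\pi_3$ be the sentence \[\exists z_1\exists z_2\exists z_3\ \Big[t(z_1+z_2+z_3)\ \&\ b(z_1z_2z_3)\ \&\ \forall x_1\forall x_2\forall x_3\forall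 x_4\ \big(\operatorname{NI}(x_1,x_2,x_3,x_4)\ \text{OR}\ \bigvee_{i\ne j,\ i,j\le 3}\operatorname{CI}(\{x_1,\dots,x_4\},I^{z_i},J_{z_j},K)\ \text{OR}\ \bigvee_{i\le 3}\operatorname{CI}(\{x_1,\dots,x_4\},[z_i,z_i],K)\big)\Big].\] Then $\pi_3$ (a positive $\exists\forall$-sentence) holds in the free lattice $\mathbf F_3$ on three generators and fails in the free lattice $\mathbf F_4$ on four generators.
   Context: $\mathbf F_n$ denotes the free lattice on $n$ generators (in the variety of all lattices, with no constants $0,1$ in the language). -}

module Defs where

open import Level using (Level; 0ℓ; _⊔_)
open import Data.Nat using (ℕ)
open import Data.Fin using (Fin; zero; suc)
open import Data.Product using (Σ; _×_; _,_; ∃-syntax)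
open import Data.Sum using (_⊎_)
open import Data.List using (List; []; _∷_)
open import Data.List.Relation.Unary.All using (All)
open import Data.List.Relation.Unary.Any using (Any)
open import Relation.Binary.PropositionalEquality using (_≢_)
open import Algebra.Lattice.Bundles using (Lattice)
open import Relation.Binary.Structures using (IsEquivalence)

-- The free lattice F_n on n generators (no constants 0,1):
-- lattice terms over Fin n modulo the least congruence containing the
-- lattice axioms (commutativity, associativity, absorption).

infixr 6 _∨ₜ_
infixr 7 _∧ₜ_
infix  4 _≈ₜ_

data Term (n : ℕ) : Set where
  var   : Fin n → Term n
  _∨ₜ_  : Term n → Term n → Term n
  _∧ₜ_  : Term n → Term n → Term n

data _≈ₜ_ {n : ℕ} : Term n → Term n → Set where
  ≈-refl  : ∀ {a} → a ≈ₜ a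
  ≈-sym   : ∀ {a b} → a ≈ₜ b → b ≈ₜ a
  ≈-trans : ∀ {a b c} → a ≈ₜ b → b ≈ₜ c → a ≈ₜ c
  ∨-cong  : ∀ {a b c d} → a ≈ₜ b → c ≈ₜ d → (a ∨ₜ c) ≈ₜ (b ∨ₜ d)
  ∧-cong  : ∀ {a b c d} → a ≈ₜ b → c ≈ₜ d → (a ∧ₜ c) ≈ₜ (b ∧ₜ d)
  ∨-comm  : ∀ a b → (a ∨ₜ b) ≈ₜ (b ∨ₜ a)
  ∧-comm  : ∀ a b → (a ∧ₜ b) ≈ₜ (b ∧ₜ a)
  ∨-assoc : ∀ a b c → ((a ∨ₜ b) ∨ₜ c) ≈ₜ (a ∨ₜ (b ∨ₜ c))
  ∧-assoc : ∀ a b c → ((a ∧ₜ b) ∧ₜ c) ≈ₜ (a ∧ₜ (b ∧ₜ c))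
  ∨-abs-∧ : ∀ a b → (a ∨ₜ (a ∧ₜ b)) ≈ₜ a
  ∧-abs-∨ : ∀ a b → (a ∧ₜ (a ∨ₜ b)) ≈ₜ a

FreeLattice : ℕ → Lattice 0ℓ 0ℓ
FreeLattice n = record
  { Carrier   = Term n
  ; _≈_       = _≈ₜ_
  ; _∨_       = _∨ₜ_
  ; _∧_       = _∧ₜ_
  ; isLattice = record
    { isEquivalence = record { refl = ≈-refl ; sym = ≈-sym ; trans = ≈-trans }
    ; ∨-comm  = ∨-comm
    ; ∨-assoc = ∨-assoc
    ; ∨-cong  = ∨-cong
    ; ∧-comm  = ∧-comm
    ; ∧-assoc = ∧-assoc
    ; ∧-cong  = ∧-cong
    ; absorptive = ∨-abs-∧ , ∧-abs-∨
    }
  }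

module _ {c ℓ : Level} (L : Lattice c ℓ) where
  open Lattice L

  _≤L_ : Carrier → Carrier → Set ℓ
  a ≤L b = (a ∨ b) ≈ b

  NI : Carrier → Carrier → Carrier → Carrier → Set ℓ
  NI x₁ x₂ x₃ x₄ =
      ((x₁ ≤L (x₂ ∨ x₃ ∨ x₄)) ⊎ (x₂ ≤L (x₁ ∨ x₃ ∨ x₄)) ⊎
       (x₃ ≤L (x₁ ∨ x₂ ∨ x₄)) ⊎ (x₄ ≤L (x₁ ∨ x₂ ∨ x₃)))
    ⊎ (((x₂ ∧ x₃ ∧ x₄) ≤L x₁) ⊎ ((x₁ ∧ x₃ ∧ x₄) ≤L x₂) ⊎
       ((x₁ ∧ x₂ ∧ x₄) ≤L x₃) ⊎ ((x₁ ∧ x₂ ∧ x₃) ≤L x₄))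

  t : Carrier → Set (c ⊔ ℓ)
  t u = ∀ w → w ≤L u

  b : Carrier → Set (c ⊔ ℓ)
  b u = ∀ w → u ≤L w

  Interval : Set c
  Interval = Carrier × Carrier

  _∈I_ : Carrier → Interval → Set ℓ
  x ∈I (lo , hi) = (lo ≤L x) × (x ≤L hi)

  CI : List Carrier → List Interval → Set (c ⊔ ℓ)
  CI X Is = All (λ x → Any (λ I → x ∈I I) Is) X

  other₁ other₂ : Fin 3 → Fin 3
  other₁ zero             = suc zero
  other₁ (suc zero)       = zero
  other₁ (suc (suc zero)) = zero
  other₂ zero             = suc (suc zero)
  other₂ (suc zero)       = suc (suc zero)
  other₂ (suc (suc zero)) = suc zero

  module Intervals (z₁ z₂ z₃ : Carrier) where
    z : Fin 3 → Carrier
    z zero             = z₁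
    z (suc zero)       = z₂
    z (suc (suc zero)) = z₃

    med : Carrier
    med = (z₁ ∧ z₂) ∨ (z₁ ∧ z₃) ∨ (z₂ ∧ z₃)

    dmed : Carrier
    dmed = (z₁ ∨ z₂) ∧ (z₁ ∨ z₃) ∧ (z₂ ∨ z₃)

    Iᶻ : Fin 3 → Interval
    Iᶻ i = (z i ∨ (z (other₁ i) ∧ z (other₂ i))) , (z i ∨ dmed)

    Jᶻ : Fin 3 → Interval
    Jᶻ i = (z i ∧ med) , (z i ∧ (z (other₁ i) ∨ z (other₂ i)))

    K : Interval
    K = med , dmed

  π₃ : Set (c ⊔ ℓ)
  π₃ = ∃[ z₁ ] ∃[ z₂ ] ∃[ z₃ ]
         ( t (z₁ ∨ z₂ ∨ z₃)
         × b (z₁ ∧ z₂ ∧ z₃)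
         × (∀ x₁ x₂ x₃ x₄ →
              NI x₁ x₂ x₃ x₄
            ⊎ (Σ (Fin 3) λ i → Σ (Fin 3) λ j → (i ≢ j) ×
                 CI (x₁ ∷ x₂ ∷ x₃ ∷ x₄ ∷ [])
                    (Iᶻ z₁ z₂ z₃ i ∷ Jᶻ z₁ z₂ z₃ j ∷ K z₁ z₂ z₃ ∷ []))
            ⊎ (Σ (Fin 3) λ i →
                 CI (x₁ ∷ x₂ ∷ x₃ ∷ x₄ ∷ [])
                    ((z z₁ z₂ z₃ i , z z₁ z₂ z₃ i) ∷ K z₁ z₂ z₃ ∷ []))))
    where open Intervals

-- Take z₁, z₂, z₃ to be the generators of F₃. Then F₃ is covered by 24 blocks: the 21 elements
-- top, bottom, z_i, z_j + z_k, z_j z_k, (z_i + z_j)(z_i + z_k), z_i z_j + z_i z_k and the 7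
-- intervals I^{z_i}, J_{z_i}, K. Indeed the join or meet of two blocks is contained in a block,
-- so by induction every element lies in one. A disjunct of the body of π₃ holds for all x_k in
-- given blocks as soon as the corresponding inequalities hold between the bounds of the blocks,
-- and these are decided by Whitman's solution of the word problem. So π₃ in F₃ reduces to a
-- finite check over the 24⁴ quadruples of blocks.
--
-- In F₄ take x₁, …, x₄ to be the generators. Evaluating in the
-- two-element lattice at the valuation true only at x_k, or true everywhere but at x_k, shows
-- that the generators violate NI. Each alternative of CI offers at most three intervals, so two
-- distinct generators x_k, x_l share an interval [c, d]. In a distributive lattice the intervals
-- of π₃ collapse, c = d, and the valuation φ true only at x_k lies below the valuation ψ true
-- everywhere but at x_l; hence 1 = φ(x_k) ≤ φ(d) ≤ ψ(d) = ψ(c) ≤ ψ(x_l) = 0.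

module Submission where

open import Level using (Level)
open import Data.Nat using (ℕ; _<_; z<s; s<s)
open import Data.Fin using (Fin; zero; suc; _≟_)
open import Data.Fin.Properties using (pigeonhole; <⇒≢)
open import Data.Bool using (Bool; true; false; T; not; _∧_; _∨_)
open import Data.Bool.Properties using (T-∧; T-∨; ∨-∧-lattice)
open import Data.Bool.ListAction using (all; any)
open import Data.Product using (Σ; ∃-syntax; _×_; _,_; proj₁; proj₂)
import Data.Product as Product
open import Data.Sum using (_⊎_; inj₁; inj₂; [_,_]′)
import Data.Sum as Sum
open import Data.List using (List; []; _∷_; allFin; length; lookup; tabulate; concat)
open import Data.List.Relation.Unary.All using (All; []; _∷_)
import Data.List.Relation.Unary.All as All
import Data.List.Relation.Unary.All.Properties as Allₚ
open import Data.List.Relation.Unary.Any using (Any; here; there; index; satisfied)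
import Data.List.Relation.Unary.Any as Any
import Data.List.Relation.Unary.Any.Properties as Anyₚ
open import Data.List.Relation.Binary.Pointwise using (Pointwise; []; _∷_)
open import Data.List.Membership.Propositional using (_∈_)
open import Data.List.Membership.Propositional.Properties using (∈-concat⁺′; ∈-tabulate⁺; ∈-lookup)
open import Function using (_∘_; Equivalence)
open import Relation.Nullary using (¬_)
open import Relation.Nullary.Decidable
  using (⌊_⌋; toWitness; fromWitness; toWitnessFalse; fromWitnessFalse)
open import Relation.Binary.PropositionalEquality using (_≡_; _≢_; refl; sym; trans; cong₂; subst)
open import Algebra.Lattice.Bundles using (Lattice)
import Algebra.Lattice.Properties.Lattice as AlgebraicLattice
import Relation.Binary.Lattice as OrderTheoretic
import Relation.Binary.Lattice.Properties.JoinSemilattice as JoinSemilattice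
import Relation.Binary.Lattice.Properties.MeetSemilattice as MeetSemilattice

open import Defs

open Equivalence using (to; from)

T-∨-elim : ∀ {a b} {P : Set} → (T a → P) → (T b → P) → T (a ∨ b) → P
T-∨-elim f g = [ f , g ]′ ∘ to T-∨

T-∨-map : ∀ {a b} {P Q : Set} → (T a → P) → (T b → Q) → T (a ∨ b) → P ⊎ Q
T-∨-map f g = Sum.map f g ∘ to T-∨

module LatticeOrder {c ℓ : Level} (L : Lattice c ℓ) where
  open Lattice L using (Carrier) renaming (_∨_ to _⊔_; _∧_ to _⊓_)

  private
    ≤-lattice = AlgebraicLattice.∨-∧-orderTheoreticLattice L

  open OrderTheoretic.Lattice ≤-lattice public
    using (_≤_; x≤x∨y; y≤x∨y; ∨-least; x∧y≤x; x∧y≤y; ∧-greatest)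
    renaming (refl to ≤-refl; trans to ≤-trans)
  open JoinSemilattice (OrderTheoretic.Lattice.joinSemilattice ≤-lattice) public
    using (∨-monotonic; x≤y⇒x∨y≈y)
  open MeetSemilattice (OrderTheoretic.Lattice.meetSemilattice ≤-lattice) public
    using (∧-monotonic)

  x≤y⇒x≤y∨z : ∀ {x y z} → x ≤ y → x ≤ y ⊔ z
  x≤y⇒x≤y∨z {y = y} {z} x≤y = ≤-trans x≤y (x≤x∨y y z)

  x≤z⇒x≤y∨z : ∀ {x y z} → x ≤ z → x ≤ y ⊔ z
  x≤z⇒x≤y∨z {y = y} {z} x≤z = ≤-trans x≤z (y≤x∨y y z)

  x≤z⇒x∧y≤z : ∀ {x y z} → x ≤ z → x ⊓ y ≤ z
  x≤z⇒x∧y≤z {x} {y} x≤z = ≤-trans (x∧y≤x x y) x≤z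

  y≤z⇒x∧y≤z : ∀ {x y z} → y ≤ z → x ⊓ y ≤ z
  y≤z⇒x∧y≤z {x} {y} y≤z = ≤-trans (x∧y≤y x y) y≤z

  infix 4 _∈ᴵ_ _⊆ᴵ_

  _∈ᴵ_ : Carrier → Interval L → Set ℓ
  x ∈ᴵ (lo , hi) = lo ≤ x × x ≤ hi

  ∈ᴵ⇒∈I : ∀ {x I} → x ∈ᴵ I → _∈I_ L x I
  ∈ᴵ⇒∈I (lo≤x , x≤hi) = x≤y⇒x∨y≈y lo≤x , x≤y⇒x∨y≈y x≤hi

  _⊆ᴵ_ : Interval L → Interval L → Set ℓ
  (a , b) ⊆ᴵ (c , d) = c ≤ a × b ≤ d

  _∨ᴵ_ _∧ᴵ_ : Interval L → Interval L → Interval L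
  (a , b) ∨ᴵ (c , d) = a ⊔ c , b ⊔ d
  (a , b) ∧ᴵ (c , d) = a ⊓ c , b ⊓ d

  ∈ᴵ-⊆ᴵ : ∀ {x I J} → x ∈ᴵ I → I ⊆ᴵ J → x ∈ᴵ J
  ∈ᴵ-⊆ᴵ (a≤x , x≤b) (c≤a , b≤d) = ≤-trans c≤a a≤x , ≤-trans x≤b b≤d

  ∈ᴵ-∨ᴵ : ∀ {x y I J} → x ∈ᴵ I → y ∈ᴵ J → x ⊔ y ∈ᴵ I ∨ᴵ J
  ∈ᴵ-∨ᴵ (a≤x , x≤b) (c≤y , y≤d) = ∨-monotonic a≤x c≤y , ∨-monotonic x≤b y≤d

  ∈ᴵ-∧ᴵ : ∀ {x y I J} → x ∈ᴵ I → y ∈ᴵ J → x ⊓ y ∈ᴵ I ∧ᴵ J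
  ∈ᴵ-∧ᴵ (a≤x , x≤b) (c≤y , y≤d) = ∧-monotonic a≤x c≤y , ∧-monotonic x≤b y≤d

module FreeLatticeOrder {n : ℕ} where
  open LatticeOrder (FreeLattice n)

  infix 4 _≤ᵇ_ _⊆ᵇ_

  _≤ᵇ_ : Term n → Term n → Bool
  s ≤ᵇ (t ∧ₜ u)          = (s ≤ᵇ t) ∧ (s ≤ᵇ u)
  (s ∨ₜ s′) ≤ᵇ t         = (s ≤ᵇ t) ∧ (s′ ≤ᵇ t)
  var x ≤ᵇ var y         = ⌊ x ≟ y ⌋
  var x ≤ᵇ (t ∨ₜ u)      = (var x ≤ᵇ t) ∨ (var x ≤ᵇ u)
  (s ∧ₜ s′) ≤ᵇ var y     = (s ≤ᵇ var y) ∨ (s′ ≤ᵇ var y)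
  (s ∧ₜ s′) ≤ᵇ (t ∨ₜ u)  = ((s ≤ᵇ t ∨ₜ u) ∨ (s′ ≤ᵇ t ∨ₜ u)) ∨ ((s ∧ₜ s′ ≤ᵇ t) ∨ (s ∧ₜ s′ ≤ᵇ u))

  ≤ᵇ⇒≤ : ∀ s t → T (s ≤ᵇ t) → s ≤ t
  ≤ᵇ⇒≤ s (t ∧ₜ u) h =
    let h₁ , h₂ = to T-∧ h in ∧-greatest (≤ᵇ⇒≤ s t h₁) (≤ᵇ⇒≤ s u h₂)
  ≤ᵇ⇒≤ (s ∨ₜ s′) (var y) h =
    let h₁ , h₂ = to T-∧ h in ∨-least (≤ᵇ⇒≤ s (var y) h₁) (≤ᵇ⇒≤ s′ (var y) h₂)
  ≤ᵇ⇒≤ (s ∨ₜ s′) (t ∨ₜ u) h =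
    let h₁ , h₂ = to T-∧ h in ∨-least (≤ᵇ⇒≤ s (t ∨ₜ u) h₁) (≤ᵇ⇒≤ s′ (t ∨ₜ u) h₂)
  ≤ᵇ⇒≤ (var x) (var y) h with toWitness h
  ... | refl = ≤-refl
  ≤ᵇ⇒≤ (var x) (t ∨ₜ u) =
    T-∨-elim (x≤y⇒x≤y∨z ∘ ≤ᵇ⇒≤ (var x) t) (x≤z⇒x≤y∨z ∘ ≤ᵇ⇒≤ (var x) u)
  ≤ᵇ⇒≤ (s ∧ₜ s′) (var y) =
    T-∨-elim (x≤z⇒x∧y≤z ∘ ≤ᵇ⇒≤ s (var y)) (y≤z⇒x∧y≤z ∘ ≤ᵇ⇒≤ s′ (var y))
  ≤ᵇ⇒≤ (s ∧ₜ s′) (t ∨ₜ u) =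
    T-∨-elim (T-∨-elim (x≤z⇒x∧y≤z ∘ ≤ᵇ⇒≤ s (t ∨ₜ u)) (y≤z⇒x∧y≤z ∘ ≤ᵇ⇒≤ s′ (t ∨ₜ u)))
             (T-∨-elim (x≤y⇒x≤y∨z ∘ ≤ᵇ⇒≤ (s ∧ₜ s′) t) (x≤z⇒x≤y∨z ∘ ≤ᵇ⇒≤ (s ∧ₜ s′) u))

  _⊆ᵇ_ : Interval (FreeLattice n) → Interval (FreeLattice n) → Bool
  (a , b) ⊆ᵇ (c , d) = (c ≤ᵇ a) ∧ (b ≤ᵇ d)

  ⊆ᵇ⇒⊆ᴵ : ∀ I J → T (I ⊆ᵇ J) → I ⊆ᴵ J
  ⊆ᵇ⇒⊆ᴵ (a , b) (c , d) h = let h₁ , h₂ = to T-∧ h in ≤ᵇ⇒≤ c a h₁ , ≤ᵇ⇒≤ b d h₂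

  above-generators⇒top : ∀ {u} → (∀ i → var i ≤ u) → ∀ w → w ≤ u
  above-generators⇒top gens≤u (var i)  = gens≤u i
  above-generators⇒top gens≤u (x ∨ₜ y) =
    ∨-least (above-generators⇒top gens≤u x) (above-generators⇒top gens≤u y)
  above-generators⇒top gens≤u (x ∧ₜ y) = x≤z⇒x∧y≤z (above-generators⇒top gens≤u x)

  below-generators⇒bottom : ∀ {u} → (∀ i → u ≤ var i) → ∀ w → u ≤ w
  below-generators⇒bottom u≤gens (var i)  = u≤gens i
  below-generators⇒bottom u≤gens (x ∨ₜ y) = x≤y⇒x≤y∨z (below-generators⇒bottom u≤gens x)
  below-generators⇒bottom u≤gens (x ∧ₜ y) =
    ∧-greatest (below-generators⇒bottom u≤gens x) (below-generators⇒bottom u≤gens y)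

module π₃-Checks {n : ℕ} where
  open LatticeOrder (FreeLattice n)
  open FreeLatticeOrder {n}

  lo hi : Interval (FreeLattice n) → Term n
  lo = proj₁
  hi = proj₂

  NIᵇ : (I₁ I₂ I₃ I₄ : Interval (FreeLattice n)) → Bool
  NIᵇ I₁ I₂ I₃ I₄ =
      ((hi I₁ ≤ᵇ lo I₂ ∨ₜ lo I₃ ∨ₜ lo I₄) ∨ (hi I₂ ≤ᵇ lo I₁ ∨ₜ lo I₃ ∨ₜ lo I₄) ∨
       (hi I₃ ≤ᵇ lo I₁ ∨ₜ lo I₂ ∨ₜ lo I₄) ∨ (hi I₄ ≤ᵇ lo I₁ ∨ₜ lo I₂ ∨ₜ lo I₃))
    ∨ ((hi I₂ ∧ₜ hi I₃ ∧ₜ hi I₄ ≤ᵇ lo I₁) ∨ (hi I₁ ∧ₜ hi I₃ ∧ₜ hi I₄ ≤ᵇ lo I₂) ∨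
       (hi I₁ ∧ₜ hi I₂ ∧ₜ hi I₄ ≤ᵇ lo I₃) ∨ (hi I₁ ∧ₜ hi I₂ ∧ₜ hi I₃ ≤ᵇ lo I₄))

  NIᵇ⇒NI : ∀ {x₁ x₂ x₃ x₄ I₁ I₂ I₃ I₄} → x₁ ∈ᴵ I₁ → x₂ ∈ᴵ I₂ → x₃ ∈ᴵ I₃ → x₄ ∈ᴵ I₄ →
           T (NIᵇ I₁ I₂ I₃ I₄) → NI (FreeLattice n) x₁ x₂ x₃ x₄
  NIᵇ⇒NI x₁∈ x₂∈ x₃∈ x₄∈ =
    T-∨-map (T-∨-map (below x₁∈ x₂∈ x₃∈ x₄∈) (T-∨-map (below x₂∈ x₁∈ x₃∈ x₄∈)
              (T-∨-map (below x₃∈ x₁∈ x₂∈ x₄∈) (below x₄∈ x₁∈ x₂∈ x₃∈))))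
            (T-∨-map (above x₁∈ x₂∈ x₃∈ x₄∈) (T-∨-map (above x₂∈ x₁∈ x₃∈ x₄∈)
              (T-∨-map (above x₃∈ x₁∈ x₂∈ x₄∈) (above x₄∈ x₁∈ x₂∈ x₃∈))))
    where
    below : ∀ {x y u w I J U W} → x ∈ᴵ I → y ∈ᴵ J → u ∈ᴵ U → w ∈ᴵ W →
            T (hi I ≤ᵇ lo J ∨ₜ lo U ∨ₜ lo W) → _≤L_ (FreeLattice n) x (y ∨ₜ u ∨ₜ w)
    below {I = I} (_ , x≤) (y≥ , _) (u≥ , _) (w≥ , _) h =
      x≤y⇒x∨y≈y (≤-trans x≤ (≤-trans (≤ᵇ⇒≤ (hi I) _ h) (∨-monotonic y≥ (∨-monotonic u≥ w≥))))
    above : ∀ {x y u w I J U W} → x ∈ᴵ I → y ∈ᴵ J → u ∈ᴵ U → w ∈ᴵ W →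
            T (hi J ∧ₜ hi U ∧ₜ hi W ≤ᵇ lo I) → _≤L_ (FreeLattice n) (y ∧ₜ u ∧ₜ w) x
    above {I = I} (x≥ , _) (_ , y≤) (_ , u≤) (_ , w≤) h =
      x≤y⇒x∨y≈y (≤-trans (∧-monotonic y≤ (∧-monotonic u≤ w≤)) (≤-trans (≤ᵇ⇒≤ _ (lo I) h) x≥))

  CIᵇ : List (Interval (FreeLattice n)) → List (Interval (FreeLattice n)) → Bool
  CIᵇ Js Is = all (λ J → any (J ⊆ᵇ_) Is) Js

  CIᵇ⇒CI : ∀ {xs Js Is} → Pointwise _∈ᴵ_ xs Js → T (CIᵇ Js Is) → CI (FreeLattice n) xs Is
  CIᵇ⇒CI [] _ = []
  CIᵇ⇒CI {Is = Is} (x∈J ∷ xs∈Js) h =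
    let h₁ , h₂ = to T-∧ h
    in Any.map (λ J⊆I → ∈ᴵ⇒∈I (∈ᴵ-⊆ᴵ x∈J (⊆ᵇ⇒⊆ᴵ _ _ J⊆I))) (Anyₚ.any⁻ _ Is h₁) ∷ CIᵇ⇒CI xs∈Js h₂

  module _ (z₁ z₂ z₃ : Term n) where
    open Intervals (FreeLattice n) z₁ z₂ z₃

    π₃-body : (x₁ x₂ x₃ x₄ : Term n) → Set
    π₃-body x₁ x₂ x₃ x₄ =
        NI (FreeLattice n) x₁ x₂ x₃ x₄
      ⊎ (Σ (Fin 3) λ i → Σ (Fin 3) λ j → (i ≢ j) ×
           CI (FreeLattice n) (x₁ ∷ x₂ ∷ x₃ ∷ x₄ ∷ []) (Iᶻ i ∷ Jᶻ j ∷ K ∷ []))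
      ⊎ (Σ (Fin 3) λ i → CI (FreeLattice n) (x₁ ∷ x₂ ∷ x₃ ∷ x₄ ∷ []) ((z i , z i) ∷ K ∷ []))

    IJ-optionᵇ : List (Interval (FreeLattice n)) → Fin 3 → Fin 3 → Bool
    IJ-optionᵇ Js i j = not ⌊ i ≟ j ⌋ ∧ CIᵇ Js (Iᶻ i ∷ Jᶻ j ∷ K ∷ [])

    Z-optionᵇ : List (Interval (FreeLattice n)) → Fin 3 → Bool
    Z-optionᵇ Js i = CIᵇ Js ((z i , z i) ∷ K ∷ [])

    π₃-bodyᵇ : (J₁ J₂ J₃ J₄ : Interval (FreeLattice n)) → Bool
    π₃-bodyᵇ J₁ J₂ J₃ J₄ =
      NIᵇ J₁ J₂ J₃ J₄ ∨
      any (λ i → any (IJ-optionᵇ Js i) (allFin 3)) (allFin 3) ∨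
      any (Z-optionᵇ Js) (allFin 3)
      where Js = J₁ ∷ J₂ ∷ J₃ ∷ J₄ ∷ []

    π₃-bodyᵇ⇒π₃-body : ∀ {x₁ x₂ x₃ x₄ J₁ J₂ J₃ J₄} →
                       x₁ ∈ᴵ J₁ → x₂ ∈ᴵ J₂ → x₃ ∈ᴵ J₃ → x₄ ∈ᴵ J₄ →
                       T (π₃-bodyᵇ J₁ J₂ J₃ J₄) → π₃-body x₁ x₂ x₃ x₄
    π₃-bodyᵇ⇒π₃-body {x₁} {x₂} {x₃} {x₄} {J₁} {J₂} {J₃} {J₄} x₁∈ x₂∈ x₃∈ x₄∈ =
      T-∨-map (NIᵇ⇒NI x₁∈ x₂∈ x₃∈ x₄∈) (T-∨-map IJ-option Z-option)
      where
      Js = J₁ ∷ J₂ ∷ J₃ ∷ J₄ ∷ []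
      xs = x₁ ∷ x₂ ∷ x₃ ∷ x₄ ∷ []
      xs∈Js = x₁∈ ∷ x₂∈ ∷ x₃∈ ∷ x₄∈ ∷ []

      IJ-option : T (any (λ i → any (IJ-optionᵇ Js i) (allFin 3)) (allFin 3)) →
                  Σ (Fin 3) λ i → Σ (Fin 3) λ j → (i ≢ j) × CI (FreeLattice n) xs (Iᶻ i ∷ Jᶻ j ∷ K ∷ [])
      IJ-option h =
        let i , hᵢ = satisfied (Anyₚ.any⁻ (λ i → any (IJ-optionᵇ Js i) (allFin 3)) (allFin 3) h)
            j , hᵢⱼ = satisfied (Anyₚ.any⁻ (IJ-optionᵇ Js i) (allFin 3) hᵢ)
            i≢j , ci = to (T-∧ {not ⌊ i ≟ j ⌋}) hᵢⱼ
        in i , j , toWitnessFalse i≢j , CIᵇ⇒CI xs∈Js ci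

      Z-option : T (any (Z-optionᵇ Js) (allFin 3)) →
                 Σ (Fin 3) λ i → CI (FreeLattice n) xs ((z i , z i) ∷ K ∷ [])
      Z-option h =
        let i , ci = satisfied (Anyₚ.any⁻ (Z-optionᵇ Js) (allFin 3) h) in i , CIᵇ⇒CI xs∈Js ci

module FreeLatticeOnThree where
  open LatticeOrder (FreeLattice 3)
  open FreeLatticeOrder {3}
  open π₃-Checks {3}

  F₃ = FreeLattice 3

  z₁ z₂ z₃ : Term 3
  z₁ = var zero
  z₂ = var (suc zero)
  z₃ = var (suc (suc zero))

  open Intervals F₃ z₁ z₂ z₃

  data Block : Set where
    top bot Kᵇ : Block
    gen joinOthers meetOthers meetJoins joinMeets Iᵇ Jᵇ : Fin 3 → Block

  point : Term 3 → Interval F₃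
  point x = x , x

  -- gen i is bounded by var i rather than z i, which only reduces for a literal i;
  -- this makes the generator case of covered immediate.
  bounds : Block → Interval F₃
  bounds top            = point (z₁ ∨ₜ z₂ ∨ₜ z₃)
  bounds bot            = point (z₁ ∧ₜ z₂ ∧ₜ z₃)
  bounds Kᵇ             = K
  bounds (gen i)        = point (var i)
  bounds (joinOthers i) = point (z (other₁ F₃ i) ∨ₜ z (other₂ F₃ i))
  bounds (meetOthers i) = point (z (other₁ F₃ i) ∧ₜ z (other₂ F₃ i))
  bounds (meetJoins i)  = point ((z i ∨ₜ z (other₁ F₃ i)) ∧ₜ (z i ∨ₜ z (other₂ F₃ i)))
  bounds (joinMeets i)  = point ((z i ∧ₜ z (other₁ F₃ i)) ∨ₜ (z i ∧ₜ z (other₂ F₃ i)))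
  bounds (Iᵇ i)         = Iᶻ i
  bounds (Jᵇ i)         = Jᶻ i

  indexedBlocks : Fin 3 → List Block
  indexedBlocks i = gen i ∷ joinOthers i ∷ meetOthers i ∷ meetJoins i ∷ joinMeets i ∷ Iᵇ i ∷ Jᵇ i ∷ []

  blocks : List Block
  blocks = top ∷ bot ∷ Kᵇ ∷ concat (tabulate indexedBlocks)

  ∈-indexed : ∀ i {q} → q ∈ indexedBlocks i → q ∈ blocks
  ∈-indexed i q∈ = there (there (there (∈-concat⁺′ q∈ (∈-tabulate⁺ {f = indexedBlocks} i))))

  ∈-blocks : ∀ q → q ∈ blocks
  ∈-blocks top            = here refl
  ∈-blocks bot            = there (here refl)
  ∈-blocks Kᵇ             = there (there (here refl))
  ∈-blocks (gen i)        = ∈-indexed i (here refl)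
  ∈-blocks (joinOthers i) = ∈-indexed i (there (here refl))
  ∈-blocks (meetOthers i) = ∈-indexed i (there (there (here refl)))
  ∈-blocks (meetJoins i)  = ∈-indexed i (there (there (there (here refl))))
  ∈-blocks (joinMeets i)  = ∈-indexed i (there (there (there (there (here refl)))))
  ∈-blocks (Iᵇ i)         = ∈-indexed i (there (there (there (there (there (here refl))))))
  ∈-blocks (Jᵇ i)         = ∈-indexed i (there (there (there (there (there (there (here refl)))))))

  all-blocks : ∀ (p : Block → Bool) → T (all p blocks) → ∀ q → T (p q)
  all-blocks p h q = All.lookup (Allₚ.all⁺ p blocks h) (∈-blocks q)

  all-blocks² : ∀ (p : Block → Block → Bool) →
                T (all (λ r → all (p r) blocks) blocks) → ∀ r s → T (p r s)
  all-blocks² p h r = all-blocks (p r) (all-blocks (λ r → all (p r) blocks) h r)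

  inside-blockᵇ : Interval F₃ → Bool
  inside-blockᵇ I = any (λ q → I ⊆ᵇ bounds q) blocks

  inside-blockᵇ⇒inside-block : ∀ I → T (inside-blockᵇ I) → ∃[ q ] I ⊆ᴵ bounds q
  inside-blockᵇ⇒inside-block I h =
    let q , I⊆q = satisfied (Anyₚ.any⁻ (λ q → I ⊆ᵇ bounds q) blocks h) in q , ⊆ᵇ⇒⊆ᴵ I (bounds q) I⊆q

  join-closed : ∀ r s → ∃[ q ] bounds r ∨ᴵ bounds s ⊆ᴵ bounds q
  join-closed r s = inside-blockᵇ⇒inside-block _
    (all-blocks² (λ r s → inside-blockᵇ (bounds r ∨ᴵ bounds s)) _ r s)

  meet-closed : ∀ r s → ∃[ q ] bounds r ∧ᴵ bounds s ⊆ᴵ bounds q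
  meet-closed r s = inside-blockᵇ⇒inside-block _
    (all-blocks² (λ r s → inside-blockᵇ (bounds r ∧ᴵ bounds s)) _ r s)

  covered : ∀ x → ∃[ q ] x ∈ᴵ bounds q
  covered (var i) = gen i , ≤-refl , ≤-refl
  covered (x ∨ₜ y) =
    let r , x∈r = covered x ; s , y∈s = covered y ; q , r∨s⊆q = join-closed r s
    in q , ∈ᴵ-⊆ᴵ (∈ᴵ-∨ᴵ x∈r y∈s) r∨s⊆q
  covered (x ∧ₜ y) =
    let r , x∈r = covered x ; s , y∈s = covered y ; q , r∧s⊆q = meet-closed r s
    in q , ∈ᴵ-⊆ᴵ (∈ᴵ-∧ᴵ x∈r y∈s) r∧s⊆q

  π₃-bodyᵇ-on-blocks : ∀ q₁ q₂ q₃ q₄ →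
                       T (π₃-bodyᵇ z₁ z₂ z₃ (bounds q₁) (bounds q₂) (bounds q₃) (bounds q₄))
  π₃-bodyᵇ-on-blocks q₁ q₂ =
    all-blocks² (λ q₃ q₄ → body q₁ q₂ q₃ q₄)
      (all-blocks² (λ q₁ q₂ → all (λ q₃ → all (body q₁ q₂ q₃) blocks) blocks) _ q₁ q₂)
    where
    body : Block → Block → Block → Block → Bool
    body q₁ q₂ q₃ q₄ = π₃-bodyᵇ z₁ z₂ z₃ (bounds q₁) (bounds q₂) (bounds q₃) (bounds q₄)

  π₃-holds : π₃ F₃
  π₃-holds = z₁ , z₂ , z₃ , x≤y⇒x∨y≈y ∘ below-top , x≤y⇒x∨y≈y ∘ above-bottom , body
    where
    below-top : ∀ w → w ≤ z₁ ∨ₜ z₂ ∨ₜ z₃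
    below-top = above-generators⇒top λ
      { zero → ≤ᵇ⇒≤ z₁ _ _ ; (suc zero) → ≤ᵇ⇒≤ z₂ _ _ ; (suc (suc zero)) → ≤ᵇ⇒≤ z₃ _ _ }
    above-bottom : ∀ w → z₁ ∧ₜ z₂ ∧ₜ z₃ ≤ w
    above-bottom = below-generators⇒bottom λ
      { zero → ≤ᵇ⇒≤ _ z₁ _ ; (suc zero) → ≤ᵇ⇒≤ _ z₂ _ ; (suc (suc zero)) → ≤ᵇ⇒≤ _ z₃ _ }
    body : ∀ x₁ x₂ x₃ x₄ → π₃-body z₁ z₂ z₃ x₁ x₂ x₃ x₄
    body x₁ x₂ x₃ x₄ =
      let q₁ , x₁∈q₁ = covered x₁ ; q₂ , x₂∈q₂ = covered x₂
          q₃ , x₃∈q₃ = covered x₃ ; q₄ , x₄∈q₄ = covered x₄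
      in π₃-bodyᵇ⇒π₃-body z₁ z₂ z₃ x₁∈q₁ x₂∈q₂ x₃∈q₃ x₄∈q₄ (π₃-bodyᵇ-on-blocks q₁ q₂ q₃ q₄)

module TwoElementLattice where
  open Intervals ∨-∧-lattice

  Iᶻ-collapses : ∀ i a b c → proj₁ (Iᶻ a b c i) ≡ proj₂ (Iᶻ a b c i)
  Iᶻ-collapses zero             true  _     _     = refl
  Iᶻ-collapses zero             false false _     = refl
  Iᶻ-collapses zero             false true  false = refl
  Iᶻ-collapses zero             false true  true  = refl
  Iᶻ-collapses (suc zero)       _     true  _     = refl
  Iᶻ-collapses (suc zero)       false false _     = refl
  Iᶻ-collapses (suc zero)       true  false _     = refl
  Iᶻ-collapses (suc (suc zero)) _     _     true  = refl
  Iᶻ-collapses (suc (suc zero)) false false false = refl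
  Iᶻ-collapses (suc (suc zero)) false true  false = refl
  Iᶻ-collapses (suc (suc zero)) true  false false = refl
  Iᶻ-collapses (suc (suc zero)) true  true  false = refl

  Jᶻ-collapses : ∀ i a b c → proj₁ (Jᶻ a b c i) ≡ proj₂ (Jᶻ a b c i)
  Jᶻ-collapses zero             false _     _     = refl
  Jᶻ-collapses zero             true  false false = refl
  Jᶻ-collapses zero             true  false true  = refl
  Jᶻ-collapses zero             true  true  _     = refl
  Jᶻ-collapses (suc zero)       _     false _     = refl
  Jᶻ-collapses (suc zero)       false true  false = refl
  Jᶻ-collapses (suc zero)       false true  true  = refl
  Jᶻ-collapses (suc zero)       true  true  _     = refl
  Jᶻ-collapses (suc (suc zero)) _     _     false = refl
  Jᶻ-collapses (suc (suc zero)) false false true  = refl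
  Jᶻ-collapses (suc (suc zero)) false true  true  = refl
  Jᶻ-collapses (suc (suc zero)) true  false true  = refl
  Jᶻ-collapses (suc (suc zero)) true  true  true  = refl

  K-collapses : ∀ a b c → proj₁ (K a b c) ≡ proj₂ (K a b c)
  K-collapses true  true  _     = refl
  K-collapses true  false false = refl
  K-collapses true  false true  = refl
  K-collapses false false _     = refl
  K-collapses false true  false = refl
  K-collapses false true  true  = refl

module BooleanValuations {n : ℕ} where
  open TwoElementLattice
  module 𝔹 = Lattice ∨-∧-lattice

  eval : (Fin n → Bool) → Term n → Bool
  eval ρ (var i)  = ρ i
  eval ρ (x ∨ₜ y) = eval ρ x ∨ eval ρ y
  eval ρ (x ∧ₜ y) = eval ρ x ∧ eval ρ y

  eval-resp : ∀ ρ {x y} → x ≈ₜ y → eval ρ x ≡ eval ρ y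
  eval-resp ρ ≈-refl          = refl
  eval-resp ρ (≈-sym p)       = sym (eval-resp ρ p)
  eval-resp ρ (≈-trans p q)   = trans (eval-resp ρ p) (eval-resp ρ q)
  eval-resp ρ (∨-cong p q)    = cong₂ _∨_ (eval-resp ρ p) (eval-resp ρ q)
  eval-resp ρ (∧-cong p q)    = cong₂ _∧_ (eval-resp ρ p) (eval-resp ρ q)
  eval-resp ρ (∨-comm x y)    = 𝔹.∨-comm (eval ρ x) (eval ρ y)
  eval-resp ρ (∧-comm x y)    = 𝔹.∧-comm (eval ρ x) (eval ρ y)
  eval-resp ρ (∨-assoc x y z) = 𝔹.∨-assoc (eval ρ x) (eval ρ y) (eval ρ z)
  eval-resp ρ (∧-assoc x y z) = 𝔹.∧-assoc (eval ρ x) (eval ρ y) (eval ρ z)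
  eval-resp ρ (∨-abs-∧ x y)   = 𝔹.∨-absorbs-∧ (eval ρ x) (eval ρ y)
  eval-resp ρ (∧-abs-∨ x y)   = 𝔹.∧-absorbs-∨ (eval ρ x) (eval ρ y)

  eval-mono : ∀ ρ {x y} → _≤L_ (FreeLattice n) x y → T (eval ρ x) → T (eval ρ y)
  eval-mono ρ x≤y ρx = subst T (eval-resp ρ x≤y) (from T-∨ (inj₁ ρx))

  eval-mono-valuation : ∀ {ρ σ} → (∀ i → T (ρ i) → T (σ i)) → ∀ x → T (eval ρ x) → T (eval σ x)
  eval-mono-valuation ρ≤σ (var i)  = ρ≤σ i
  eval-mono-valuation ρ≤σ (x ∨ₜ y) =
    from T-∨ ∘ Sum.map (eval-mono-valuation ρ≤σ x) (eval-mono-valuation ρ≤σ y) ∘ to T-∨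
  eval-mono-valuation ρ≤σ (x ∧ₜ y) =
    from T-∧ ∘ Product.map (eval-mono-valuation ρ≤σ x) (eval-mono-valuation ρ≤σ y) ∘ to T-∧

  only allBut : Fin n → Fin n → Bool
  only k i   = ⌊ i ≟ k ⌋
  allBut k i = not (only k i)

  only≤allBut : ∀ {k l} → k ≢ l → ∀ i → T (only k i) → T (allBut l i)
  only≤allBut k≢l i i≡k with toWitness i≡k
  ... | refl = fromWitnessFalse k≢l

  Degenerate : Interval (FreeLattice n) → Set
  Degenerate (lo , hi) = ∀ ρ → eval ρ lo ≡ eval ρ hi

  degenerate-separates-generators : ∀ {k l I} → k ≢ l → _∈I_ (FreeLattice n) (var k) I →
                                    _∈I_ (FreeLattice n) (var l) I → ¬ Degenerate I
  degenerate-separates-generators {k} {l} {lo , hi} k≢l (_ , k≤hi) (lo≤l , _) degenerate =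
    toWitnessFalse (eval-mono (allBut l) lo≤l allBut-lo) refl
    where
    only-hi : T (eval (only k) hi)
    only-hi = eval-mono (only k) k≤hi (fromWitness refl)
    allBut-lo : T (eval (allBut l) lo)
    allBut-lo = subst T (sym (degenerate (allBut l))) (eval-mono-valuation (only≤allBut k≢l) hi only-hi)

  generators-not-covered : ∀ Is → length Is < n → All Degenerate Is →
                           ¬ CI (FreeLattice n) (tabulate var) Is
  generators-not-covered Is |Is|<n degenerate ci =
    degenerate-separates-generators (<⇒≢ k<l) (Anyₚ.lookup-index (place k))
      (subst (λ i → _∈I_ (FreeLattice n) (var l) (lookup Is i)) (sym same) (Anyₚ.lookup-index (place l)))
      (All.lookup degenerate (∈-lookup (index (place k))))
    where
    place : ∀ k → Any (_∈I_ (FreeLattice n) (var k)) Is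
    place = Allₚ.tabulate⁻ ci
    collision = pigeonhole |Is|<n (index ∘ place)
    k = proj₁ collision
    l = proj₁ (proj₂ collision)
    k<l = proj₁ (proj₂ (proj₂ collision))
    same = proj₂ (proj₂ (proj₂ collision))

  module _ (z₁ z₂ z₃ : Term n) where
    open Intervals (FreeLattice n) z₁ z₂ z₃

    Iᶻ-degenerate : ∀ i → Degenerate (Iᶻ i)
    Iᶻ-degenerate zero             ρ = Iᶻ-collapses zero (eval ρ z₁) (eval ρ z₂) (eval ρ z₃)
    Iᶻ-degenerate (suc zero)       ρ = Iᶻ-collapses (suc zero) (eval ρ z₁) (eval ρ z₂) (eval ρ z₃)
    Iᶻ-degenerate (suc (suc zero)) ρ = Iᶻ-collapses (suc (suc zero)) (eval ρ z₁) (eval ρ z₂) (eval ρ z₃)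

    Jᶻ-degenerate : ∀ i → Degenerate (Jᶻ i)
    Jᶻ-degenerate zero             ρ = Jᶻ-collapses zero (eval ρ z₁) (eval ρ z₂) (eval ρ z₃)
    Jᶻ-degenerate (suc zero)       ρ = Jᶻ-collapses (suc zero) (eval ρ z₁) (eval ρ z₂) (eval ρ z₃)
    Jᶻ-degenerate (suc (suc zero)) ρ = Jᶻ-collapses (suc (suc zero)) (eval ρ z₁) (eval ρ z₂) (eval ρ z₃)

    K-degenerate : Degenerate K
    K-degenerate ρ = K-collapses (eval ρ z₁) (eval ρ z₂) (eval ρ z₃)

module FreeLatticeOnFour where
  open BooleanValuations {4}

  F₄ = FreeLattice 4

  x₁ x₂ x₃ x₄ : Term 4
  x₁ = var zero
  x₂ = var (suc zero)
  x₃ = var (suc (suc zero))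
  x₄ = var (suc (suc (suc zero)))

  generators-not-NI : ¬ NI F₄ x₁ x₂ x₃ x₄
  generators-not-NI (inj₁ (inj₁ p))               = eval-mono (only zero) p _
  generators-not-NI (inj₁ (inj₂ (inj₁ p)))        = eval-mono (only (suc zero)) p _
  generators-not-NI (inj₁ (inj₂ (inj₂ (inj₁ p)))) = eval-mono (only (suc (suc zero))) p _
  generators-not-NI (inj₁ (inj₂ (inj₂ (inj₂ p)))) = eval-mono (only (suc (suc (suc zero)))) p _
  generators-not-NI (inj₂ (inj₁ p))               = eval-mono (allBut zero) p _
  generators-not-NI (inj₂ (inj₂ (inj₁ p)))        = eval-mono (allBut (suc zero)) p _
  generators-not-NI (inj₂ (inj₂ (inj₂ (inj₁ p)))) = eval-mono (allBut (suc (suc zero))) p _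
  generators-not-NI (inj₂ (inj₂ (inj₂ (inj₂ p)))) = eval-mono (allBut (suc (suc (suc zero)))) p _

  π₃-fails : ¬ π₃ F₄
  π₃-fails (z₁ , z₂ , z₃ , _ , _ , body) with body x₁ x₂ x₃ x₄
  ... | inj₁ ni = generators-not-NI ni
  ... | inj₂ (inj₁ (i , j , _ , ci)) =
    generators-not-covered _ (s<s (s<s (s<s z<s)))
      (Iᶻ-degenerate z₁ z₂ z₃ i ∷ Jᶻ-degenerate z₁ z₂ z₃ j ∷ K-degenerate z₁ z₂ z₃ ∷ []) ci
  ... | inj₂ (inj₂ (i , ci)) =
    generators-not-covered _ (s<s (s<s z<s)) ((λ _ → refl) ∷ K-degenerate z₁ z₂ z₃ ∷ []) ci

theorem3p1 : π₃ (FreeLattice 3) × ¬ π₃ (FreeLattice 4)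
theorem3p1 = FreeLatticeOnThree.π₃-holds , FreeLatticeOnFour.π₃-fails
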